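{- Let $h:\omega\to\omega$ be a recursive function with $h(m)>0$ for all $m$. Let $n\ge 1$ and let $\epsilon$ be a finite partial function from $\omega$ to $\omega$, writing $e_t=\epsilon(t)$ for $t\in\mathrm{dom}(\epsilon)$. Let $g(n,\epsilon)=2^a n$ where $a=\sum_{t\in\mathrm{dom}(\epsilon)}h(e_t)$. For each pair $(t,i)$ with $t\in\mathrm{dom}(\epsilon)$ and $i<h(e_t)$ let $Q_{(t,i)}=\{\beta\in\omega^{<\omega}:\Phi^\beta_t(e_t)\downarrow=i\}$, and let $Q=\{\beta\in\omega^{<\omega}:\exists t\in\mathrm{dom}(\epsilon)\,[\Phi^\beta_t(e_t)\downarrow<h(e_t)]\}$. If there is a $g(n,\epsilon)$-good tree for $Q$ from some string $\alpha$, then for some pair $(t,i)$ there is an $n$-good tree from $\alpha$ for $Q_{(t,i)}$.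
   Context: $(\Phi_t)$ is a standard enumeration of Turing functionals; for a string $\beta$, $\Phi^\beta_t(x)\downarrow=i$ means the computation with oracle $\beta$ halts with output $i$, querying the oracle only at arguments in the domain of $\beta$. A tree is a finite set of pairwise incomparable strings in $\omega^{<\omega}$. A nonempty tree $T$ is $a$-good from $\sigma$ if every $\tau\in T$ extends $\sigma$, and for each string $\tau$ with $\sigma\subseteq\tau\subsetneq\rho$ for some $\rho\in T$, at least $a$ immediate successors $\tau*k$ of $\tau$ are initial segments of elements of $T$; it is $a$-good from $\sigma$ for $P$ if moreover $T\subseteq P$. -}

module Defs where

open import Data.Nat using (ℕ; _≤_; _<_; _*_; _^_)
open import Data.List using (List; []; _∷_; _++_; length; map)
open import Data.Nat.ListAction using (sum)
open import Data.List.Membership.Propositional using (_∈_)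
open import Data.List.Relation.Unary.All using (All)
open import Data.List.Relation.Unary.Unique.Propositional using (Unique)
open import Data.Product using (Σ; ∃; _×_; _,_)
open import Relation.Binary.PropositionalEquality using (_≡_; _≢_)
open import Relation.Nullary using (¬_)

Str : Set
Str = List ℕ

_⊑_ : Str → Str → Set
τ ⊑ ρ = ∃ λ r → τ ++ r ≡ ρ

_⊏_ : Str → Str → Set
τ ⊏ ρ = (τ ⊑ ρ) × (τ ≢ ρ)

_⋆_ : Str → ℕ → Str
τ ⋆ k = τ ++ (k ∷ [])

-- A finite set of strings, represented by a list (membership via _∈_).
-- It is a tree if its elements are pairwise incomparable.
IsTree : List Str → Set
IsTree T = ∀ {τ ρ} → τ ∈ T → ρ ∈ T → τ ⊑ ρ → τ ≡ ρ

ManySucc : ℕ → List Str → Str → Set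
ManySucc a T τ =
  Σ (List ℕ) λ ks → (a ≤ length ks) × Unique ks
    × All (λ k → ∃ λ ρ → (ρ ∈ T) × ((τ ⋆ k) ⊑ ρ)) ks

Good : ℕ → Str → List Str → Set
Good a σ T =
  IsTree T
  × (∃ λ ρ → ρ ∈ T)
  × (∀ {τ} → τ ∈ T → σ ⊑ τ)
  × (∀ τ ρ → ρ ∈ T → σ ⊑ τ → τ ⊏ ρ → ManySucc a T τ)

GoodFor : ℕ → Str → (Str → Set) → List Str → Set
GoodFor a σ P T = Good a σ T × (∀ {τ} → τ ∈ T → P τ)

-- Oracle computations: Φ t β x i  stands for  Φ^β_t(x)↓ = i
-- (halting with output i, querying the oracle only inside dom β).
Functionals : Set₁
Functionals = ℕ → Str → ℕ → ℕ → Set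

-- A finite partial function ε : ω ⇀ ω is given by a duplicate-free domain
-- list `dom` together with values `e t` (only used for t ∈ dom).
-- a = Σ_{t ∈ dom ε} h(e_t)
sumH : (h : ℕ → ℕ) (dom : List ℕ) (e : ℕ → ℕ) → ℕ
sumH h dom e = sum (map (λ t → h (e t)) dom)

gBound : (h : ℕ → ℕ) (n : ℕ) (dom : List ℕ) (e : ℕ → ℕ) → ℕ
gBound h n dom e = 2 ^ sumH h dom e * n

Qti : Functionals → (e : ℕ → ℕ) → ℕ → ℕ → Str → Set
Qti Φ e t i β = Φ t β (e t) i

Qall : Functionals → (h : ℕ → ℕ) (dom : List ℕ) (e : ℕ → ℕ) → Str → Set
Qall Φ h dom e β = ∃ λ t → (t ∈ dom) × ∃ λ i → Φ t β (e t) i × (i < h (e t))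

module Submission where

-- Every string of T carries at least one colour (t , i) ∈ Cs witnessing Q,
-- where Cs enumerates the pairs with t ∈ dom ε and i < h(e_t), so
-- |Cs| = a.  We prove the general colouring principle: if T is g-good from
-- α and every element of T carries a colour from a finite list Cs, and
-- g > |Cs|·(n−1), then some colour c has a subtree of T that is n-good
-- from α and consists of strings of colour c.  The proof is by induction
-- on the height of T above a node τ: a leaf τ ∈ T is a one-element tree of
-- its own colour; an inner node has g successors, each of which has a
-- coloured subtree by induction, and by the pigeonhole principle n of them
-- share a colour c; grafting those n subtrees onto τ gives an n-good tree
-- from τ of colour c.  The theorem follows since 2^a·n > a·(n−1).

open import Defs
open import Data.Nat using (ℕ; _<_; _≤_; zero; suc; _+_; _*_; _^_; z≤n; s≤s; z<s; _≤?_)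
open import Data.Nat.Properties
open import Data.List using (List; []; _∷_; [_]; _++_; length; map; upTo; concatMap)
open import Data.List.Properties using (++-assoc; ++-cancelˡ; ++-identityʳ; ∷-injectiveˡ; length-++; length-map; length-upTo)
import Data.List.Properties as List
open import Data.List.Extrema.Nat using (max; xs≤max)
open import Data.List.Membership.Propositional using (_∈_)
open import Data.List.Membership.Propositional.Properties using (∈-map⁺; ∈-map⁻; ∈-++⁺ˡ; ∈-++⁺ʳ; ∈-++⁻; ∈-upTo⁺; ∈-upTo⁻; ∈-concatMap⁺; ∈-concatMap⁻)
open import Data.List.Relation.Binary.Subset.Propositional using () renaming (_⊆_ to _⊆ₘ_)
open import Data.List.Relation.Binary.Sublist.Propositional using (_⊆_; []; _∷_; _∷ʳ_; ⊆-trans)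
open import Data.List.Relation.Binary.Sublist.Propositional.Properties using (All-resp-⊆)
open import Data.List.Relation.Unary.Unique.Propositional using (Unique)
open import Data.List.Relation.Unary.All as All using (All; []; _∷_)
open import Data.List.Relation.Unary.AllPairs using ([]; _∷_)
open import Data.List.Relation.Unary.Any as Any using (here; there)
open import Data.Product using (Σ; ∃; _×_; _,_; proj₁; proj₂)
import Data.Product.Properties as Product
open import Data.Sum using (inj₁; inj₂)
open import Relation.Binary.Definitions using (DecidableEquality)
open import Relation.Nullary using (yes; no; contradiction)
open import Relation.Binary.PropositionalEquality using (_≡_; refl; sym; trans; cong; subst; module ≡-Reasoning)

_≟ˢ_ : DecidableEquality Str
_≟ˢ_ = List.≡-dec _≟_

⊑-refl : ∀ {τ} → τ ⊑ τ
⊑-refl {τ} = [] , ++-identityʳ τ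

⊑-trans : ∀ {τ ρ π} → τ ⊑ ρ → ρ ⊑ π → τ ⊑ π
⊑-trans {τ} (r , refl) (s , refl) = r ++ s , sym (++-assoc τ r s)

⊑-⋆ : ∀ τ k → τ ⊑ (τ ⋆ k)
⊑-⋆ τ k = k ∷ [] , refl

⊑⇒length≤ : ∀ {τ ρ} → τ ⊑ ρ → length τ ≤ length ρ
⊑⇒length≤ {τ} (r , refl) = subst (length τ ≤_) (sym (length-++ τ)) (m≤m+n _ _)

⊏⇒length< : ∀ {τ ρ} → τ ⊏ ρ → length τ < length ρ
⊏⇒length< {τ} (([] , eq) , τ≢ρ) = contradiction (trans (sym (++-identityʳ τ)) eq) τ≢ρ
⊏⇒length< {τ} ((k ∷ r , refl) , _) = subst (length τ <_) (sym (length-++ τ)) (m<m+n (length τ) z<s)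

⊏⇒⋆⊑ : ∀ {τ ρ} → τ ⊏ ρ → ∃ λ k → (τ ⋆ k) ⊑ ρ
⊏⇒⋆⊑ {τ} (([] , eq) , τ≢ρ) = contradiction (trans (sym (++-identityʳ τ)) eq) τ≢ρ
⊏⇒⋆⊑ {τ} ((k ∷ r , eq) , _) = k , r , trans (++-assoc τ (k ∷ []) r) eq

⋆-unique : ∀ τ {k k′ ρ} → (τ ⋆ k) ⊑ ρ → (τ ⋆ k′) ⊑ ρ → k ≡ k′
⋆-unique τ {k} {k′} (r , eq) (r′ , eq′) = ∷-injectiveˡ (++-cancelˡ τ (k ∷ r) (k′ ∷ r′) (begin
  τ ++ k ∷ r             ≡⟨ sym (++-assoc τ (k ∷ []) r) ⟩
  (τ ⋆ k) ++ r           ≡⟨ trans eq (sym eq′) ⟩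
  (τ ⋆ k′) ++ r′         ≡⟨ ++-assoc τ (k′ ∷ []) r′ ⟩
  τ ++ k′ ∷ r′           ∎))
  where open ≡-Reasoning

-- Passing to a successor trades one unit of remaining height for length.
length-⋆ : ∀ τ k d → length (τ ⋆ k) + d ≡ length τ + suc d
length-⋆ τ k d = trans (cong (_+ d) (length-++ τ)) (+-assoc (length τ) 1 d)

module _ {a : ℕ} {σ : Str} {T : List Str} (G : Good a σ T) where

  good-tree : IsTree T
  good-tree = proj₁ G

  good-nonempty : ∃ λ ρ → ρ ∈ T
  good-nonempty = proj₁ (proj₂ G)

  good-root : ∀ {τ} → τ ∈ T → σ ⊑ τ
  good-root = proj₁ (proj₂ (proj₂ G))

  good-branching : ∀ τ ρ → ρ ∈ T → σ ⊑ τ → τ ⊏ ρ → ManySucc a T τ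
  good-branching = proj₂ (proj₂ (proj₂ G))

IsTree-⊆ : ∀ {S T} → S ⊆ₘ T → IsTree T → IsTree S
IsTree-⊆ S⊆T treeT τ∈ ρ∈ = treeT (S⊆T τ∈) (S⊆T ρ∈)

ManySucc-mono : ∀ {a S S′ τ} → S ⊆ₘ S′ → ManySucc a S τ → ManySucc a S′ τ
ManySucc-mono S⊆S′ (ks , wide , unique , below) =
  ks , wide , unique , All.map (λ { (ρ , ρ∈ , τk⊑ρ) → ρ , S⊆S′ ρ∈ , τk⊑ρ }) below

record GoodSubtree (n : ℕ) (T : List Str) (P : Str → Set) (σ : Str) : Set where
  field
    nodes : List Str
    nodes⊆T : nodes ⊆ₘ T
    good : Good n σ nodes
    nodes-P : ∀ {x} → x ∈ nodes → P x

open GoodSubtree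

singleton-subtree : ∀ {n T P τ} → τ ∈ T → P τ → GoodSubtree n T P τ
singleton-subtree {τ = τ} τ∈T Pτ = record
  { nodes = [ τ ]
  ; nodes⊆T = λ { (here refl) → τ∈T }
  ; good = (λ { (here refl) (here refl) _ → refl })
         , (τ , here refl)
         , (λ { (here refl) → ⊑-refl })
         , λ { τ′ ρ (here refl) τ⊑τ′ τ′⊏τ → contradiction (⊑⇒length≤ τ⊑τ′) (<⇒≱ (⊏⇒length< τ′⊏τ)) }
  ; nodes-P = λ { (here refl) → Pτ }
  }

module Graft {m : ℕ} {T : List Str} {P : Str → Set} (τ : Str) where

  Branch : ℕ → Set
  Branch k = GoodSubtree (suc m) T P (τ ⋆ k)

  graft : ∀ {ks} → All Branch ks → List Str
  graft []       = []
  graft (b ∷ bs) = nodes b ++ graft bs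

  ∈-graft⁺ : ∀ {ks k x} (bs : All Branch ks) (k∈ : k ∈ ks) → x ∈ nodes (All.lookup bs k∈) → x ∈ graft bs
  ∈-graft⁺ (b ∷ bs) (here refl) x∈ = ∈-++⁺ˡ x∈
  ∈-graft⁺ (b ∷ bs) (there k∈)  x∈ = ∈-++⁺ʳ (nodes b) (∈-graft⁺ bs k∈ x∈)

  ∈-graft⁻ : ∀ {ks x} (bs : All Branch ks) → x ∈ graft bs
           → ∃ λ k → Σ (k ∈ ks) λ k∈ → x ∈ nodes (All.lookup bs k∈)
  ∈-graft⁻ (b ∷ bs) x∈ with ∈-++⁻ (nodes b) x∈
  ... | inj₁ x∈b = _ , here refl , x∈b
  ... | inj₂ x∈bs with ∈-graft⁻ bs x∈bs
  ...   | k , k∈ , x∈b = k , there k∈ , x∈b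

  graft-subtree : ∀ {ks} → IsTree T → Unique ks → suc m ≤ length ks → All Branch ks
                → GoodSubtree (suc m) T P τ
  graft-subtree {[]} _ _ () _
  graft-subtree {ks@(_ ∷ _)} treeT distinct wide bs = record
    { nodes = graft bs
    ; nodes⊆T = ⊆T
    ; good = IsTree-⊆ ⊆T treeT , nonempty , root , branching
    ; nodes-P = inP
    }
    where
    branch : ∀ {k} → k ∈ ks → Branch k
    branch = All.lookup bs

    ⊆T : graft bs ⊆ₘ T
    ⊆T x∈ with ∈-graft⁻ bs x∈
    ... | _ , k∈ , x∈b = nodes⊆T (branch k∈) x∈b

    inP : ∀ {x} → x ∈ graft bs → P x
    inP x∈ with ∈-graft⁻ bs x∈
    ... | _ , k∈ , x∈b = nodes-P (branch k∈) x∈b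

    below : ∀ {k x} (k∈ : k ∈ ks) → x ∈ nodes (branch k∈) → (τ ⋆ k) ⊑ x
    below k∈ = good-root (good (branch k∈))

    root : ∀ {x} → x ∈ graft bs → τ ⊑ x
    root x∈ with ∈-graft⁻ bs x∈
    ... | k , k∈ , x∈b = ⊑-trans (⊑-⋆ τ k) (below k∈ x∈b)

    witness : ∀ {k} → k ∈ ks → ∃ λ ρ → (ρ ∈ graft bs) × ((τ ⋆ k) ⊑ ρ)
    witness k∈ with good-nonempty (good (branch k∈))
    ... | ρ , ρ∈ = ρ , ∈-graft⁺ bs k∈ ρ∈ , below k∈ ρ∈

    nonempty : ∃ λ ρ → ρ ∈ graft bs
    nonempty with witness (here refl)
    ... | ρ , ρ∈ , _ = ρ , ρ∈

    -- At τ itself the successors ks branch; above τ we are inside a single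
    -- branch τ⋆k, which is determined by the node ρ, and branches there.
    branching : ∀ τ′ ρ → ρ ∈ graft bs → τ ⊑ τ′ → τ′ ⊏ ρ → ManySucc (suc m) (graft bs) τ′
    branching τ′ ρ ρ∈ τ⊑τ′ τ′⊏ρ with τ ≟ˢ τ′
    ... | yes refl = ks , wide , distinct , All.tabulate witness
    ... | no τ≢τ′ with ⊏⇒⋆⊑ (τ⊑τ′ , τ≢τ′) | ∈-graft⁻ bs ρ∈
    ...   | k′ , τk′⊑τ′ | k , k∈ , ρ∈b with ⋆-unique τ (below k∈ ρ∈b) (⊑-trans τk′⊑τ′ (proj₁ τ′⊏ρ))
    ...     | refl = ManySucc-mono (∈-graft⁺ bs k∈) (good-branching (good (branch k∈)) τ′ ρ ρ∈b τk′⊑τ′ τ′⊏ρ)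

Unique-⊆ : ∀ {A : Set} {xs ys : List A} → ys ⊆ xs → Unique xs → Unique ys
Unique-⊆ []             []              = []
Unique-⊆ (_ ∷ʳ ys⊆xs)   (_ ∷ distinct)  = Unique-⊆ ys⊆xs distinct
Unique-⊆ (refl ∷ ys⊆xs) (x∉ ∷ distinct) = All-resp-⊆ ys⊆xs x∉ ∷ Unique-⊆ ys⊆xs distinct

remaining : ∀ {k m x y z} → suc (m + k) ≤ x → x ≤ y + z → y ≤ m → suc k ≤ z
remaining {k} {m} {x} {y} {z} bound split-x y≤m = +-cancelˡ-≤ m (suc k) z (begin
  m + suc k   ≡⟨ +-suc m k ⟩
  suc (m + k) ≤⟨ bound ⟩
  x           ≤⟨ split-x ⟩
  y + z       ≤⟨ +-monoˡ-≤ z y≤m ⟩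
  m + z       ∎)
  where open ≤-Reasoning

module Pigeonhole {A X : Set} (_≟ᶜ_ : DecidableEquality A) (R : A → X → Set) where

  Coloured : List A → X → Set
  Coloured Cs x = ∃ λ c → (c ∈ Cs) × R c x

  record Split (c : A) (Cs : List A) (xs : List X) : Set where
    constructor split
    field
      ofColour others : List X
      ofColour⊆ : ofColour ⊆ xs
      others⊆ : others ⊆ xs
      ofColour-R : All (R c) ofColour
      others-Coloured : All (Coloured Cs) others
      length-split : length xs ≤ length ofColour + length others

  separate : ∀ c Cs {xs} → All (Coloured (c ∷ Cs)) xs → Split c Cs xs
  separate c Cs [] = split [] [] [] [] [] [] z≤n
  separate c Cs {x ∷ xs} ((c′ , c′∈ , r) ∷ cols) with c′ ≟ᶜ c | separate c Cs cols
  ... | yes refl | split ys zs ys⊆ zs⊆ ysR zsC len =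
    split (x ∷ ys) zs (refl ∷ ys⊆) (x ∷ʳ zs⊆) (r ∷ ysR) zsC (s≤s len)
  ... | no c′≢c | split ys zs ys⊆ zs⊆ ysR zsC len = split ys (x ∷ zs) (x ∷ʳ ys⊆) (refl ∷ zs⊆) ysR
    (otherColour c′∈ ∷ zsC) (subst (suc (length xs) ≤_) (sym (+-suc (length ys) (length zs))) (s≤s len))
    where
    otherColour : c′ ∈ c ∷ Cs → Coloured Cs x
    otherColour (here c′≡c) = contradiction c′≡c c′≢c
    otherColour (there c′∈Cs) = c′ , c′∈Cs , r

  pigeonhole : ∀ m Cs {xs} → All (Coloured Cs) xs → suc (length Cs * m) ≤ length xs
             → ∃ λ c → (c ∈ Cs) × ∃ λ ys → (ys ⊆ xs) × (suc m ≤ length ys) × All (R c) ys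
  pigeonhole m [] [] ()
  pigeonhole m [] ((_ , () , _) ∷ _) _
  pigeonhole m (c ∷ Cs) cols bound with separate c Cs cols
  ... | split ys zs ys⊆ zs⊆ ysR zsC len with suc m ≤? length ys
  ...   | yes many = c , here refl , ys , ys⊆ , many , ysR
  ...   | no few with pigeonhole m Cs zsC (remaining bound len (≤-pred (≰⇒> few)))
  ...     | c′ , c′∈ , ws , ws⊆ , many , wsR = c′ , there c′∈ , ws , ⊆-trans ws⊆ zs⊆ , many , wsR

module Colouring {C : Set} (_≟ᶜ_ : DecidableEquality C) (Cs : List C) (P : C → Str → Set)
  (m g : ℕ) (wide : suc (length Cs * m) ≤ g)
  (α : Str) (T : List Str) (goodT : Good g α T) (coloured : ∀ {β} → β ∈ T → ∃ λ c → (c ∈ Cs) × P c β)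
  where

  Solution : Str → Set
  Solution τ = ∃ λ c → (c ∈ Cs) × GoodSubtree (suc m) T (P c) τ

  -- Induction on the height d of T above τ.  If τ ∈ T it is a leaf of
  -- its own colour; otherwise τ lies properly below an element of T, so
  -- d > 0 and τ has g successors, each below an element of T.
  solve : ∀ d τ → α ⊑ τ → (∃ λ ρ → (ρ ∈ T) × (τ ⊑ ρ))
        → (∀ {ρ} → ρ ∈ T → length ρ ≤ length τ + d) → Solution τ
  solve d τ α⊑τ (ρ , ρ∈T , τ⊑ρ) height with τ ≟ˢ ρ
  ... | yes refl with coloured ρ∈T
  ...   | c , c∈ , Pc = c , c∈ , singleton-subtree ρ∈T Pc
  solve zero τ α⊑τ (ρ , ρ∈T , τ⊑ρ) height | no τ≢ρ =
    contradiction (subst (length ρ ≤_) (+-identityʳ (length τ)) (height ρ∈T)) (<⇒≱ (⊏⇒length< (τ⊑ρ , τ≢ρ)))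
  solve (suc d) τ α⊑τ (ρ , ρ∈T , τ⊑ρ) height | no τ≢ρ =
    node (good-branching goodT τ ρ ρ∈T α⊑τ (τ⊑ρ , τ≢ρ))
    where
    open Pigeonhole _≟ᶜ_ (λ c k → GoodSubtree (suc m) T (P c) (τ ⋆ k))

    solveSuccessor : ∀ {k} → (∃ λ ρ → (ρ ∈ T) × ((τ ⋆ k) ⊑ ρ)) → Coloured Cs k
    solveSuccessor {k} below = solve d (τ ⋆ k) (⊑-trans α⊑τ (⊑-⋆ τ k)) below
      (λ {ρ′} ρ′∈T → subst (length ρ′ ≤_) (sym (length-⋆ τ k d)) (height ρ′∈T))

    node : ManySucc g T τ → Solution τ
    node (ks , g≤ks , distinct , successors)
      with pigeonhole m Cs (All.map solveSuccessor successors) (≤-trans wide g≤ks)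
    ... | c , c∈ , ys , ys⊆ks , many , branches =
      c , c∈ , Graft.graft-subtree τ (good-tree goodT) (Unique-⊆ ys⊆ks distinct) many branches

  T-height : ∀ {ρ} → ρ ∈ T → length ρ ≤ length α + max 0 (map length T)
  T-height ρ∈T = ≤-trans (All.lookup (xs≤max 0 (map length T)) (∈-map⁺ length ρ∈T)) (m≤n+m _ _)

  colouring : ∃ λ c → (c ∈ Cs) × ∃ λ S → GoodFor (suc m) α (P c) S
  colouring with good-nonempty goodT
  ... | ρ , ρ∈T with solve (max 0 (map length T)) α ⊑-refl (ρ , ρ∈T , good-root goodT ρ∈T) T-height
  ...   | c , c∈ , S = c , c∈ , nodes S , good S , nodes-P S

colourBlock : (h : ℕ → ℕ) (e : ℕ → ℕ) → ℕ → List (ℕ × ℕ)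
colourBlock h e t = map (t ,_) (upTo (h (e t)))

colours : (h : ℕ → ℕ) (dom : List ℕ) (e : ℕ → ℕ) → List (ℕ × ℕ)
colours h dom e = concatMap (colourBlock h e) dom

length-colours : ∀ h dom e → length (colours h dom e) ≡ sumH h dom e
length-colours h [] e = refl
length-colours h (t ∷ dom) e = begin
  length (colourBlock h e t ++ colours h dom e)          ≡⟨ length-++ (colourBlock h e t) ⟩
  length (colourBlock h e t) + length (colours h dom e)  ≡⟨ cong (_+ length (colours h dom e)) block-size ⟩
  h (e t) + length (colours h dom e)                     ≡⟨ cong (h (e t) +_) (length-colours h dom e) ⟩
  h (e t) + sumH h dom e                                 ∎
  where
  open ≡-Reasoning
  block-size : length (colourBlock h e t) ≡ h (e t)
  block-size = trans (length-map (t ,_) (upTo (h (e t)))) (length-upTo (h (e t)))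

∈-colours⁺ : ∀ h dom e {t i} → t ∈ dom → i < h (e t) → (t , i) ∈ colours h dom e
∈-colours⁺ h dom e t∈ i< =
  ∈-concatMap⁺ (colourBlock h e) (Any.map (λ { refl → ∈-map⁺ (_ ,_) (∈-upTo⁺ i<) }) t∈)

∈-colours⁻ : ∀ h dom e {t i} → (t , i) ∈ colours h dom e → (t ∈ dom) × (i < h (e t))
∈-colours⁻ h dom e {t} {i} c∈ = Any.map (λ c∈ₜ → proj₁ (tagged c∈ₜ)) found , bounded
  where
  found : Any.Any (λ t′ → (t , i) ∈ colourBlock h e t′) dom
  found = ∈-concatMap⁻ (colourBlock h e) c∈

  tagged : ∀ {t′} → (t , i) ∈ colourBlock h e t′ → (t ≡ t′) × (i < h (e t))
  tagged c∈ₜ with ∈-map⁻ (_ ,_) c∈ₜ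
  ... | j , j∈ , refl = refl , ∈-upTo⁻ j∈

  bounded : i < h (e t)
  bounded = proj₂ (tagged (proj₂ (Any.satisfied found)))

a<2^a : ∀ a → a < 2 ^ a
a<2^a zero = z<s
a<2^a (suc a) = begin-strict
  suc a           <⟨ s≤s (a<2^a a) ⟩
  suc (2 ^ a)     ≡⟨ +-comm 1 (2 ^ a) ⟩
  2 ^ a + 1       ≤⟨ +-monoʳ-≤ (2 ^ a) (m^n>0 2 a) ⟩
  2 ^ a + 2 ^ a   ≡⟨ cong (2 ^ a +_) (sym (+-identityʳ (2 ^ a))) ⟩
  2 * 2 ^ a       ∎
  where open ≤-Reasoning

a*m<2^a*[1+m] : ∀ a m → a * m < 2 ^ a * suc m
a*m<2^a*[1+m] a m = begin
  1 + a * m           ≤⟨ +-mono-≤ (m^n>0 2 a) (*-monoˡ-≤ m (<⇒≤ (a<2^a a))) ⟩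
  2 ^ a + 2 ^ a * m   ≡⟨ sym (*-suc (2 ^ a) m) ⟩
  2 ^ a * suc m       ∎
  where open ≤-Reasoning

lemma2p8 : (Φ : Functionals) (h : ℕ → ℕ) → (∀ m → 0 < h m)
    → (n : ℕ) → 1 ≤ n
    → (dom : List ℕ) → Unique dom → (e : ℕ → ℕ)
    → (α : Str)
    → (∃ λ T → GoodFor (gBound h n dom e) α (Qall Φ h dom e) T)
    → ∃ λ t → ∃ λ i → (t ∈ dom) × (i < h (e t))
        × (∃ λ T → GoodFor n α (Qti Φ e t i) T)
lemma2p8 Φ h _ zero () dom _ e α _
lemma2p8 Φ h _ (suc m) _ dom _ e α (T , goodT , inQ) =
  let ((t , i) , c∈ , S , goodS) = colouring
      (t∈ , i<) = ∈-colours⁻ h dom e c∈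
  in t , i , t∈ , i< , S , goodS
  where
  wide : suc (length (colours h dom e) * m) ≤ gBound h (suc m) dom e
  wide = subst (λ a → suc (a * m) ≤ gBound h (suc m) dom e) (sym (length-colours h dom e)) (a*m<2^a*[1+m] (sumH h dom e) m)

  coloured : ∀ {β} → β ∈ T → ∃ λ c → (c ∈ colours h dom e) × Qti Φ e (proj₁ c) (proj₂ c) β
  coloured β∈T with inQ β∈T
  ... | t , t∈ , i , Φβ , i< = (t , i) , ∈-colours⁺ h dom e t∈ i< , Φβ

  open Colouring (Product.≡-dec _≟_ _≟_) (colours h dom e) (λ c → Qti Φ e (proj₁ c) (proj₂ c))
    m (gBound h (suc m) dom e) wide α T goodT coloured
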